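{- Let $(*_1)$ and $(*_2)$ be distinct difference equalities in $x_1,\dots,x_k$ such that the collection $\{(*_1),(*_2)\}$ is valid and AP-free. Then $(*_1)$ and $(*_2)$ share at most $2$ variables (i.e., at most two variables appear in both).
   Context: A difference equality in $x_1,\dots,x_k$ is a linear equation over $\mathbb{R}$ of the form $x_{i_1} - x_{i_2} - x_{i_3} + x_{i_4} = 0$ with $i_1,\dots,i_4 \in \{1,\dots,k\}$ not necessarily distinct and $\{i_1,i_4\} \neq \{i_2,i_3\}$; equations are identified up to rearrangement (including multiplication by $-1$), so distinct means their left-hand sides are not equal up to sign. A variable appears in an equation if its coefficient is nonzero. A collection implies a linear equation if that equation's left-hand side is a linear combination of the collection's left-hand sides. A collection is valid if it does not imply $x_i - x_j = 0$ for any $i \neq j$, and AP-free if it does not imply $x_{i_1} - 2x_{i_2} + x_{i_3} = 0$ for any distinct $i_1,i_2,i_3$. -}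

module Defs where

open import Data.Nat using (ℕ)
open import Data.Fin using (Fin; _≟_)
open import Data.Rational using (ℚ; 0ℚ; 1ℚ; _+_; _-_; _*_; -_)
open import Data.Product using (Σ; _×_; _,_)
open import Data.Sum using (_⊎_)
open import Relation.Nullary using (¬_; yes; no)
open import Relation.Binary.PropositionalEquality using (_≡_; _≢_)

-- A difference equality  x_{i1} - x_{i2} - x_{i3} + x_{i4} = 0  in x_1..x_k,
-- given by its four (not necessarily distinct) indices, with {i1,i4} ≠ {i2,i3} as sets.
record DiffEq (k : ℕ) : Set where
  constructor diffEq
  field
    i₁ i₂ i₃ i₄ : Fin k
    nondeg : ¬ ( (i₁ ≡ i₂ ⊎ i₁ ≡ i₃) × (i₄ ≡ i₂ ⊎ i₄ ≡ i₃)
               × (i₂ ≡ i₁ ⊎ i₂ ≡ i₄) × (i₃ ≡ i₁ ⊎ i₃ ≡ i₄) )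

LinForm : ℕ → Set
LinForm k = Fin k → ℚ

δ : {k : ℕ} → Fin k → LinForm k
δ i j with i ≟ j
... | yes _ = 1ℚ
... | no  _ = 0ℚ

lhs : {k : ℕ} → DiffEq k → LinForm k
lhs e j = ((δ i₁ j - δ i₂ j) - δ i₃ j) + δ i₄ j
  where open DiffEq e

-- equations identified up to sign: distinct iff lhs differ up to sign
Distinct : {k : ℕ} → DiffEq k → DiffEq k → Set
Distinct e f = ¬ (∀ j → lhs e j ≡ lhs f j) × ¬ (∀ j → lhs e j ≡ - lhs f j)

Appears : {k : ℕ} → Fin k → DiffEq k → Set
Appears j e = lhs e j ≢ 0ℚ

Implies₂ : {k : ℕ} → DiffEq k → DiffEq k → LinForm k → Set
Implies₂ e f v = Σ ℚ λ a → Σ ℚ λ b → ∀ j → a * lhs e j + b * lhs f j ≡ v j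

Valid₂ : {k : ℕ} → DiffEq k → DiffEq k → Set
Valid₂ {k} e f = (i j : Fin k) → i ≢ j → ¬ Implies₂ e f (λ t → δ i t - δ j t)

APFree₂ : {k : ℕ} → DiffEq k → DiffEq k → Set
APFree₂ {k} e f = (a b c : Fin k) → a ≢ b → a ≢ c → b ≢ c →
  ¬ Implies₂ e f (λ t → (δ a t - (δ b t + δ b t)) + δ c t)

Shared : {k : ℕ} → Fin k → DiffEq k → DiffEq k → Set
Shared j e f = Appears j e × Appears j f

module Submission where

-- A single difference equality that is valid and AP-free already has four distinct
-- indices, since coinciding indices make it vanish or turn it into x_i - x_j or into a
-- three-term progression.
-- The symmetries of x_a - x_b - x_c + x_d (exchanging a with d, b with c, and negation
-- together with (a b)(c d) or (a c)(b d)) act transitively on the four positions, so three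
-- shared variables can be normalised to e = x_a - x_b - x_c + x_d and either
-- f = x_a - x_b - x_c + x_s, where e - f = x_d - x_s (or e = f), or
-- f = x_a - x_b - x_r + x_c, where e - f = x_d - 2x_c + x_r (or (e + f)/2 = x_a - x_b if d = r).

open import Defs
open import Data.Nat using (ℕ)
open import Data.Fin using (Fin; _≟_)
open import Data.List using ([]; _∷_)
open import Data.List.Membership.Propositional using (_∈_)
open import Data.List.Relation.Unary.All using (All; []; _∷_)
import Data.List.Relation.Unary.All as All
open import Data.List.Relation.Unary.Any using (here; there)
open import Data.Rational using (ℚ; 0ℚ; 1ℚ; ½; _+_; _-_; _*_; -_)
open import Data.Rational.Properties
  using (+-comm; +-identityʳ; *-zeroˡ; neg-injective; +-0-group)
  renaming (_≟_ to _≟ℚ_)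
open import Data.Rational.Solver using (module +-*-Solver)
open import Algebra.Properties.Group +-0-group using (⁻¹-involutive)
open import Data.Product using (Σ; ∃; ∃₂; _×_; _,_)
open import Data.Sum using (_⊎_; inj₁; inj₂)
open import Data.Empty using (⊥; ⊥-elim)
open import Function using (case_of_)
open import Relation.Nullary using (¬_; yes; no; ¬?; contradiction)
open import Relation.Unary using (Decidable)
open import Relation.Binary.PropositionalEquality
  using (_≡_; _≢_; refl; sym; trans; cong; ≢-sym)

open +-*-Solver using (solve; _:=_; _:+_; _:-_; _:*_; :-_; con)

module _ {A : Set} where

  pigeonhole : {x y j₁ j₂ j₃ : A} → j₁ ≢ j₂ → j₁ ≢ j₃ → j₂ ≢ j₃ →
               ¬ All (λ j → j ≡ x ⊎ j ≡ y) (j₁ ∷ j₂ ∷ j₃ ∷ [])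
  pigeonhole ≢₁₂ ≢₁₃ ≢₂₃ (inj₁ refl ∷ inj₁ refl ∷ _         ∷ []) = ≢₁₂ refl
  pigeonhole ≢₁₂ ≢₁₃ ≢₂₃ (inj₂ refl ∷ inj₂ refl ∷ _         ∷ []) = ≢₁₂ refl
  pigeonhole ≢₁₂ ≢₁₃ ≢₂₃ (inj₁ refl ∷ inj₂ refl ∷ inj₁ refl ∷ []) = ≢₁₃ refl
  pigeonhole ≢₁₂ ≢₁₃ ≢₂₃ (inj₁ refl ∷ inj₂ refl ∷ inj₂ refl ∷ []) = ≢₂₃ refl
  pigeonhole ≢₁₂ ≢₁₃ ≢₂₃ (inj₂ refl ∷ inj₁ refl ∷ inj₁ refl ∷ []) = ≢₂₃ refl
  pigeonhole ≢₁₂ ≢₁₃ ≢₂₃ (inj₂ refl ∷ inj₁ refl ∷ inj₂ refl ∷ []) = ≢₁₃ refl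

  ∈₄-elim : {R : Set} {j a b c d : A} → j ∈ a ∷ b ∷ c ∷ d ∷ [] →
            (j ≡ a → R) → (j ≡ b → R) → (j ≡ c → R) → (j ≡ d → R) → R
  ∈₄-elim (here j≡a)                         ka kb kc kd = ka j≡a
  ∈₄-elim (there (here j≡b))                 ka kb kc kd = kb j≡b
  ∈₄-elim (there (there (here j≡c)))         ka kb kc kd = kc j≡c
  ∈₄-elim (there (there (there (here j≡d)))) ka kb kc kd = kd j≡d

  excluded : {P : A → Set} {R : Set} {x j : A} → ¬ P x → P j → j ≡ x → R
  excluded ¬px pj refl = contradiction pj ¬px

  module _ {P : A → Set} {a b c d j₁ j₂ j₃ : A} (≢₁₂ : j₁ ≢ j₂) (≢₁₃ : j₁ ≢ j₃) (≢₂₃ : j₂ ≢ j₃)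
           (js : All (λ j → j ∈ a ∷ b ∷ c ∷ d ∷ [] × P j) (j₁ ∷ j₂ ∷ j₃ ∷ [])) where

    notConfinedToTwo : {x y : A} → ¬ (∀ {j} → j ∈ a ∷ b ∷ c ∷ d ∷ [] → P j → j ≡ x ⊎ j ≡ y)
    notConfinedToTwo into = pigeonhole ≢₁₂ ≢₁₃ ≢₂₃ (All.map (λ (m , p) → into m p) js)

    threeOfFour : Decidable P →
      (P a × P b × P c) ⊎ (P a × P b × P d) ⊎ (P a × P c × P d) ⊎ (P b × P c × P d)
    threeOfFour P? with P? a | P? b | P? c | P? d
    ... | yes pa | yes pb | yes pc | _      = inj₁ (pa , pb , pc)
    ... | yes pa | yes pb | no _   | yes pd = inj₂ (inj₁ (pa , pb , pd))
    ... | yes pa | no _   | yes pc | yes pd = inj₂ (inj₂ (inj₁ (pa , pc , pd)))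
    ... | no _   | yes pb | yes pc | yes pd = inj₂ (inj₂ (inj₂ (pb , pc , pd)))
    ... | no ¬pa | no ¬pb | _      | _      =
      ⊥-elim (notConfinedToTwo λ m p → ∈₄-elim m (excluded ¬pa p) (excluded ¬pb p) inj₁ inj₂)
    ... | no ¬pa | yes _  | no ¬pc | _      =
      ⊥-elim (notConfinedToTwo λ m p → ∈₄-elim m (excluded ¬pa p) inj₁ (excluded ¬pc p) inj₂)
    ... | no ¬pa | yes _  | yes _  | no ¬pd =
      ⊥-elim (notConfinedToTwo λ m p → ∈₄-elim m (excluded ¬pa p) inj₁ inj₂ (excluded ¬pd p))
    ... | yes _  | no ¬pb | no ¬pc | _      =
      ⊥-elim (notConfinedToTwo λ m p → ∈₄-elim m inj₁ (excluded ¬pb p) (excluded ¬pc p) inj₂)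
    ... | yes _  | no ¬pb | yes _  | no ¬pd =
      ⊥-elim (notConfinedToTwo λ m p → ∈₄-elim m inj₁ (excluded ¬pb p) inj₂ (excluded ¬pd p))
    ... | yes _  | yes _  | no ¬pc | no ¬pd =
      ⊥-elim (notConfinedToTwo λ m p → ∈₄-elim m inj₁ inj₂ (excluded ¬pc p) (excluded ¬pd p))

module _ {k : ℕ} where

  form : Fin k → Fin k → Fin k → Fin k → LinForm k
  form a b c d t = ((δ a t - δ b t) - δ c t) + δ d t

  diff : Fin k → Fin k → LinForm k
  diff i j t = δ i t - δ j t

  threeTermAP : Fin k → Fin k → Fin k → LinForm k
  threeTermAP a b c t = (δ a t - (δ b t + δ b t)) + δ c t

  Spans : LinForm k → LinForm k → LinForm k → Set
  Spans u w v = Σ ℚ λ α → Σ ℚ λ β → ∀ t → α * u t + β * w t ≡ v t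

  record Admissible (u w : LinForm k) : Set where
    constructor mkAdmissible
    field
      ≢same     : ¬ (∀ t → u t ≡ w t)
      ≢opposite : ¬ (∀ t → u t ≡ - w t)
      valid     : ∀ i j → i ≢ j → ¬ Spans u w (diff i j)
      apFree    : ∀ a b c → a ≢ b → a ≢ c → b ≢ c → ¬ Spans u w (threeTermAP a b c)

  open Admissible

  Nontrivial : LinForm k → Set
  Nontrivial u = ∃ λ t → u t ≢ 0ℚ

  _≈±_ : LinForm k → LinForm k → Set
  u ≈± u' = (∀ t → u' t ≡ u t) ⊎ (∀ t → u' t ≡ - u t)

  neg-flip : ∀ {x y : ℚ} → x ≡ - y → y ≡ - x
  neg-flip {x} {y} x≡-y = trans (sym (⁻¹-involutive y)) (cong -_ (sym x≡-y))

  ≈±-support : ∀ {u u' t} → u ≈± u' → u t ≢ 0ℚ → u' t ≢ 0ℚ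
  ≈±-support {t = t} (inj₁ u'≡u)  ut≢0 u't≡0 = ut≢0 (trans (sym (u'≡u t)) u't≡0)
  ≈±-support {t = t} (inj₂ u'≡-u) ut≢0 u't≡0 = ut≢0 (neg-injective (trans (sym (u'≡-u t)) u't≡0))

  Nontrivial-resp : ∀ {u u'} → u ≈± u' → Nontrivial u → Nontrivial u'
  Nontrivial-resp σ (t , ut≢0) = t , ≈±-support σ ut≢0

  Spans-comm : ∀ {u w v} → Spans u w v → Spans w u v
  Spans-comm {u} {w} (α , β , h) = β , α , λ t → trans (+-comm (β * w t) (α * u t)) (h t)

  Spans-respˡ : ∀ {u u' w v} → u ≈± u' → Spans u' w v → Spans u w v
  Spans-respˡ {u} {w = w} (inj₁ u'≡u) (α , β , h) =
    α , β , λ t → trans (cong (λ x → α * x + β * w t) (sym (u'≡u t))) (h t)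
  Spans-respˡ {u} {w = w} (inj₂ u'≡-u) (α , β , h) =
    - α , β , λ t → trans (move-neg α (u t) (β * w t))
                          (trans (cong (λ x → α * x + β * w t) (sym (u'≡-u t))) (h t))
    where
    move-neg : ∀ α x y → (- α) * x + y ≡ α * (- x) + y
    move-neg = solve 3 (λ α x y → (:- α) :* x :+ y := α :* (:- x) :+ y) refl

  Spans-respʳ : ∀ {u w w' v} → w ≈± w' → Spans u w' v → Spans u w v
  Spans-respʳ σ s = Spans-comm (Spans-respˡ σ (Spans-comm s))

  Admissible-sym : ∀ {u w} → Admissible u w → Admissible w u
  Admissible-sym adm = mkAdmissible
    (λ w≡u → ≢same adm (λ t → sym (w≡u t)))
    (λ w≡-u → ≢opposite adm (λ t → neg-flip (w≡-u t)))
    (λ i j i≢j s → valid adm i j i≢j (Spans-comm s))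
    (λ a b c a≢b a≢c b≢c s → apFree adm a b c a≢b a≢c b≢c (Spans-comm s))

  Admissible-respʳ : ∀ {u w w'} → w ≈± w' → Admissible u w → Admissible u w'
  Admissible-respʳ {u} {w} {w'} σ adm = mkAdmissible (≢same′ σ) (≢opposite′ σ)
    (λ i j i≢j s → valid adm i j i≢j (Spans-respʳ σ s))
    (λ a b c a≢b a≢c b≢c s → apFree adm a b c a≢b a≢c b≢c (Spans-respʳ σ s))
    where
    ≢same′ : w ≈± w' → ¬ (∀ t → u t ≡ w' t)
    ≢same′ (inj₁ w'≡w)  u≡w' = ≢same adm (λ t → trans (u≡w' t) (w'≡w t))
    ≢same′ (inj₂ w'≡-w) u≡w' = ≢opposite adm (λ t → trans (u≡w' t) (w'≡-w t))
    ≢opposite′ : w ≈± w' → ¬ (∀ t → u t ≡ - w' t)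
    ≢opposite′ (inj₁ w'≡w)  u≡-w' = ≢opposite adm (λ t → trans (u≡-w' t) (cong -_ (w'≡w t)))
    ≢opposite′ (inj₂ w'≡-w) u≡-w' = ≢same adm (λ t →
      trans (u≡-w' t) (trans (cong -_ (w'≡-w t)) (⁻¹-involutive (w t))))

  Admissible-respˡ : ∀ {u u' w} → u ≈± u' → Admissible u w → Admissible u' w
  Admissible-respˡ σ adm = Admissible-sym (Admissible-respʳ σ (Admissible-sym adm))

  module _ (a b c d : Fin k) where

    form-swap₂₃ : form a b c d ≈± form a c b d
    form-swap₂₃ = inj₁ λ t → solve 4 (λ a b c d → ((a :- c) :- b) :+ d := ((a :- b) :- c) :+ d)
                                      refl (δ a t) (δ b t) (δ c t) (δ d t)

    form-swap₁₄ : form a b c d ≈± form d b c a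
    form-swap₁₄ = inj₁ λ t → solve 4 (λ a b c d → ((d :- b) :- c) :+ a := ((a :- b) :- c) :+ d)
                                      refl (δ a t) (δ b t) (δ c t) (δ d t)

    form-swap₁₂-swap₃₄ : form a b c d ≈± form b a d c
    form-swap₁₂-swap₃₄ = inj₂ λ t → solve 4 (λ a b c d → ((b :- a) :- d) :+ c := :- (((a :- b) :- c) :+ d))
                                             refl (δ a t) (δ b t) (δ c t) (δ d t)

    form-swap₁₃-swap₂₄ : form a b c d ≈± form c d a b
    form-swap₁₃-swap₂₄ = inj₂ λ t → solve 4 (λ a b c d → ((c :- d) :- a) :+ b := :- (((a :- b) :- c) :+ d))
                                             refl (δ a t) (δ b t) (δ c t) (δ d t)

  δ-≢ : ∀ {i j : Fin k} → i ≢ j → δ i j ≡ 0ℚ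
  δ-≢ {i} {j} i≢j with i ≟ j
  ... | yes i≡j = contradiction i≡j i≢j
  ... | no _    = refl

  form-outside : ∀ {a b c d j} → a ≢ j → b ≢ j → c ≢ j → d ≢ j → form a b c d j ≡ 0ℚ
  form-outside a≢j b≢j c≢j d≢j rewrite δ-≢ a≢j | δ-≢ b≢j | δ-≢ c≢j | δ-≢ d≢j = refl

  form-support : ∀ a b c d {j} → form a b c d j ≢ 0ℚ → j ∈ a ∷ b ∷ c ∷ d ∷ []
  -- Splitting on j ≟ a rather than a ≟ j keeps the with-abstraction out of δ a j inside nz.
  form-support a b c d {j} nz with j ≟ a | j ≟ b | j ≟ c | j ≟ d
  ... | yes j≡a | _       | _       | _       = here j≡a
  ... | no _    | yes j≡b | _       | _       = there (here j≡b)
  ... | no _    | no _    | yes j≡c | _       = there (there (here j≡c))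
  ... | no _    | no _    | no _    | yes j≡d = there (there (there (here j≡d)))
  ... | no j≢a  | no j≢b  | no j≢c  | no j≢d  =
    contradiction (form-outside (≢-sym j≢a) (≢-sym j≢b) (≢-sym j≢c) (≢-sym j≢d)) nz

  form-toFront : ∀ p q r s {j} → form p q r s j ≢ 0ℚ →
                 ∃₂ λ q' r' → ∃ λ s' → form p q r s ≈± form j q' r' s'
  form-toFront p q r s nz with form-support p q r s nz
  ... | here refl                         = q , r , s , inj₁ (λ _ → refl)
  ... | there (here refl)                 = p , s , r , form-swap₁₂-swap₃₄ p q r s
  ... | there (there (here refl))         = s , p , q , form-swap₁₃-swap₂₄ p q r s
  ... | there (there (there (here refl))) = q , r , p , form-swap₁₄ p q r s

  spans-left : ∀ {u w v} α → (∀ t → α * u t ≡ v t) → Spans u w v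
  spans-left {u} {w} α h = α , 0ℚ , λ t →
    trans (cong (α * u t +_) (*-zeroˡ (w t))) (trans (+-identityʳ (α * u t)) (h t))

  AllDistinct : Fin k → Fin k → Fin k → Fin k → Set
  AllDistinct a b c d = a ≢ b × a ≢ c × a ≢ d × b ≢ c × b ≢ d × c ≢ d

  Admissible⇒distinct : ∀ a b c d {w} → Nontrivial (form a b c d) →
                        Admissible (form a b c d) w → AllDistinct a b c d
  Admissible⇒distinct a b c d (t₀ , nz) adm with a ≟ b
  ... | yes refl with c ≟ d
  ...   | yes refl = contradiction (solve 2 (λ x y → ((x :- x) :- y) :+ y := con 0ℚ) refl (δ a t₀) (δ c t₀)) nz
  ...   | no c≢d = contradiction (spans-left 1ℚ λ t →
            solve 3 (λ x y z → con 1ℚ :* (((x :- x) :- y) :+ z) := z :- y) refl (δ a t) (δ c t) (δ d t))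
          (valid adm d c (≢-sym c≢d))
  Admissible⇒distinct a b c d (t₀ , nz) adm | no a≢b with a ≟ c
  ... | yes refl with d ≟ b
  ...   | yes refl = contradiction (solve 2 (λ x y → ((x :- y) :- x) :+ y := con 0ℚ) refl (δ a t₀) (δ b t₀)) nz
  ...   | no d≢b = contradiction (spans-left 1ℚ λ t →
            solve 3 (λ x y z → con 1ℚ :* (((x :- y) :- x) :+ z) := z :- y) refl (δ a t) (δ b t) (δ d t))
          (valid adm d b d≢b)
  Admissible⇒distinct a b c d (t₀ , nz) adm | no a≢b | no a≢c with d ≟ b | d ≟ c
  ... | yes refl | _ = contradiction (spans-left 1ℚ λ t →
          solve 3 (λ x y z → con 1ℚ :* (((x :- y) :- z) :+ y) := x :- z) refl (δ a t) (δ d t) (δ c t))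
        (valid adm a c a≢c)
  ... | no _ | yes refl = contradiction (spans-left 1ℚ λ t →
          solve 3 (λ x y z → con 1ℚ :* (((x :- y) :- z) :+ z) := x :- y) refl (δ a t) (δ b t) (δ d t))
        (valid adm a b a≢b)
  ... | no d≢b | no d≢c with a ≟ d | b ≟ c
  ... | yes refl | yes refl = contradiction (spans-left ½ λ t →
          solve 2 (λ x y → con ½ :* (((x :- y) :- y) :+ x) := x :- y) refl (δ a t) (δ b t))
        (valid adm a b a≢b)
  ... | yes refl | no b≢c = contradiction (spans-left (- 1ℚ) λ t →
          solve 3 (λ x y z → con (- 1ℚ) :* (((x :- y) :- z) :+ x) := (y :- (x :+ x)) :+ z)
                refl (δ a t) (δ b t) (δ c t))
        (apFree adm b a c (≢-sym a≢b) b≢c a≢c)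
  ... | no a≢d | yes refl = contradiction (spans-left 1ℚ λ t →
          solve 3 (λ x y z → con 1ℚ :* (((x :- y) :- y) :+ z) := (x :- (y :+ y)) :+ z)
                refl (δ a t) (δ b t) (δ d t))
        (apFree adm a b d a≢b a≢d (≢-sym d≢b))
  ... | no a≢d | no b≢c = a≢b , a≢c , a≢d , b≢c , ≢-sym d≢b , ≢-sym d≢c

  ¬Admissible-lastReplaced : ∀ a b c d s → ¬ Admissible (form a b c d) (form a b c s)
  ¬Admissible-lastReplaced a b c d s adm with d ≟ s
  ... | yes refl = ≢same adm (λ _ → refl)
  ... | no d≢s   = valid adm d s d≢s (1ℚ , - 1ℚ , λ t →
    solve 5 (λ a b c d s → con 1ℚ :* (((a :- b) :- c) :+ d) :+ con (- 1ℚ) :* (((a :- b) :- c) :+ s) := d :- s)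
            refl (δ a t) (δ b t) (δ c t) (δ d t) (δ s t))

  ¬Admissible-thirdToLast : ∀ {a b c d r} → a ≢ b → c ≢ d → c ≢ r →
                            ¬ Admissible (form a b c d) (form a b r c)
  ¬Admissible-thirdToLast {a} {b} {c} {d} {r} a≢b c≢d c≢r adm with d ≟ r
  ... | yes refl = valid adm a b a≢b (½ , ½ , λ t →
    solve 4 (λ a b c d → con ½ :* (((a :- b) :- c) :+ d) :+ con ½ :* (((a :- b) :- d) :+ c) := a :- b)
            refl (δ a t) (δ b t) (δ c t) (δ d t))
  ... | no d≢r   = apFree adm d c r (≢-sym c≢d) d≢r c≢r (1ℚ , - 1ℚ , λ t →
    solve 5 (λ a b c d r → con 1ℚ :* (((a :- b) :- c) :+ d) :+ con (- 1ℚ) :* (((a :- b) :- r) :+ c)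
                           := (d :- (c :+ c)) :+ r)
            refl (δ a t) (δ b t) (δ c t) (δ d t) (δ r t))

  ¬Admissible-sameFirstTwo : ∀ {a b c d r s} → a ≢ c → b ≢ c → a ≢ b → c ≢ d → r ≢ s →
    Admissible (form a b c d) (form a b r s) → form a b r s c ≢ 0ℚ → ⊥
  ¬Admissible-sameFirstTwo {a} {b} {c} {d} {r} {s} a≢c b≢c a≢b c≢d r≢s adm c∈
    with form-support a b r s c∈
  ... | here refl                         = a≢c refl
  ... | there (here refl)                 = b≢c refl
  ... | there (there (here refl))         = ¬Admissible-lastReplaced a b c d s adm
  ... | there (there (there (here refl))) = ¬Admissible-thirdToLast a≢b c≢d (≢-sym r≢s) adm

  ¬Admissible-sameFirst : ∀ {a b c d q r s} → AllDistinct a b c d → AllDistinct a q r s →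
    Admissible (form a b c d) (form a q r s) → form a q r s b ≢ 0ℚ → form a q r s c ≢ 0ℚ → ⊥
  ¬Admissible-sameFirst {a} {b} {c} {d} {q} {r} {s}
    (a≢b , a≢c , _ , b≢c , b≢d , c≢d) (_ , _ , _ , q≢r , q≢s , r≢s) adm b∈ c∈
    with form-support a q r s b∈
  ... | here refl = a≢b refl
  ... | there (here refl) = ¬Admissible-sameFirstTwo a≢c b≢c a≢b c≢d r≢s adm c∈
  ... | there (there (here refl)) =
    ¬Admissible-sameFirstTwo a≢c b≢c a≢b c≢d q≢s
      (Admissible-respʳ (form-swap₂₃ a q b s) adm) (≈±-support (form-swap₂₃ a q b s) c∈)
  ... | there (there (there (here refl))) with form-support a q r b c∈
  ...   | here refl = a≢c refl
  ...   | there (here refl) =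
    ¬Admissible-sameFirstTwo a≢b (≢-sym b≢c) a≢c b≢d r≢s
      (Admissible-respˡ (form-swap₂₃ a b c d) adm) b∈
  ...   | there (there (here refl)) =
    ¬Admissible-sameFirstTwo a≢b (≢-sym b≢c) a≢c b≢d q≢s
      (Admissible-respʳ (form-swap₂₃ a q c b) (Admissible-respˡ (form-swap₂₃ a b c d) adm))
      (≈±-support (form-swap₂₃ a q c b) b∈)
  ...   | there (there (there (here refl))) = b≢c refl

  ¬Admissible-supportsFirstThree : ∀ a b c d p q r s → Nontrivial (form a b c d) →
    Admissible (form a b c d) (form p q r s) →
    form p q r s a ≢ 0ℚ → form p q r s b ≢ 0ℚ → form p q r s c ≢ 0ℚ → ⊥
  ¬Admissible-supportsFirstThree a b c d p q r s nt adm a∈ b∈ c∈ with form-toFront p q r s a∈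
  ... | q′ , r′ , s′ , σ =
    ¬Admissible-sameFirst (Admissible⇒distinct a b c d nt adm′)
      (Admissible⇒distinct a q′ r′ s′ (b , b∈′) (Admissible-sym adm′)) adm′ b∈′ (≈±-support σ c∈)
    where
    adm′ : Admissible (form a b c d) (form a q′ r′ s′)
    adm′ = Admissible-respʳ σ adm
    b∈′ : form a q′ r′ s′ b ≢ 0ℚ
    b∈′ = ≈±-support σ b∈

  ¬Admissible-threeShared : ∀ a b c d p q r s {j₁ j₂ j₃} → j₁ ≢ j₂ → j₁ ≢ j₃ → j₂ ≢ j₃ →
    Admissible (form a b c d) (form p q r s) →
    ¬ All (λ j → form a b c d j ≢ 0ℚ × form p q r s j ≢ 0ℚ) (j₁ ∷ j₂ ∷ j₃ ∷ [])
  ¬Admissible-threeShared a b c d p q r s ≢₁₂ ≢₁₃ ≢₂₃ adm shared@((e₁ , _) ∷ _) =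
    case threeOfFour ≢₁₂ ≢₁₃ ≢₂₃ (All.map (λ (e , f) → form-support a b c d e , f) shared)
                     (λ j → ¬? (form p q r s j ≟ℚ 0ℚ)) of λ where
      (inj₁ (pa , pb , pc))                → ¬Admissible-supportsFirstThree a b c d p q r s nt adm pa pb pc
      (inj₂ (inj₁ (pa , pb , pd)))         → via b a d c (form-swap₁₂-swap₃₄ a b c d) pb pa pd
      (inj₂ (inj₂ (inj₁ (pa , pc , pd))))  → via c d a b (form-swap₁₃-swap₂₄ a b c d) pc pd pa
      (inj₂ (inj₂ (inj₂ (pb , pc , pd))))  → via d b c a (form-swap₁₄ a b c d) pd pb pc
    where
    nt : Nontrivial (form a b c d)
    nt = _ , e₁
    via : ∀ a' b' c' d' → form a b c d ≈± form a' b' c' d' →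
          form p q r s a' ≢ 0ℚ → form p q r s b' ≢ 0ℚ → form p q r s c' ≢ 0ℚ → ⊥
    via a' b' c' d' σ = ¬Admissible-supportsFirstThree a' b' c' d' p q r s
                                  (Nontrivial-resp σ nt) (Admissible-respˡ σ adm)

lemma3p2 : {k : ℕ} (e f : DiffEq k) → Distinct e f → Valid₂ e f → APFree₂ e f →
    (j₁ j₂ j₃ : Fin k) → j₁ ≢ j₂ → j₁ ≢ j₃ → j₂ ≢ j₃ →
    ¬ (Shared j₁ e f × Shared j₂ e f × Shared j₃ e f)
lemma3p2 (diffEq a b c d _) (diffEq p q r s _) (e≢f , e≢-f) valid₂ apFree₂
         _ _ _ ≢₁₂ ≢₁₃ ≢₂₃ (shared₁ , shared₂ , shared₃) =
  ¬Admissible-threeShared a b c d p q r s ≢₁₂ ≢₁₃ ≢₂₃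
    (mkAdmissible e≢f e≢-f valid₂ apFree₂) (shared₁ ∷ shared₂ ∷ shared₃ ∷ [])
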